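{- Let $p$ be a prime, $e\geq 1$ an integer, $A,B\in\mathbb{Z}/p^e\mathbb{Z}$ (represented by integers) with $-(4A^3+27B^2)$ a unit, and $E=E_{A,B}(\mathbb{Z}/p^e\mathbb{Z})$. There is a polynomial $\mathsf{f}\in\mathbb{Z}[x]$ of degree at most $e-1$ such that for every $P\in E^\infty$ there is $X\in p(\mathbb{Z}/p^e\mathbb{Z})$ with $P=(X:1:\mathsf{f}(X))$. Moreover, $\mathsf{f}(X)\equiv X^3+AX^7+BX^9 \bmod p^{10}$.
   Context: $\mathbb{P}^2(R)$ is the set of triples in $R^3$ generating the unit ideal modulo multiplication by units; $E_{A,B}(R)=\{(X:Y:Z)\in\mathbb{P}^2(R): Y^2Z=X^3+AXZ^2+BZ^3\}$. The points at infinity $E^\infty$ are the points of $E$ that have no representative of the form $(X:Y:1)$. For $X\in\mathbb{Z}/p^e\mathbb{Z}$ and $t\geq 1$, "$X\equiv 0 \bmod p^t$" means $X\in p^t(\mathbb{Z}/p^e\mathbb{Z})$ (which is $\{0\}$ if $t\geq e$); congruences modulo $p^t$ in $\mathbb{Z}/p^e\mathbb{Z}$ are understood accordingly, and the "moreover" congruence is meant for the values at every $X\in p(\mathbb{Z}/p^e\mathbb{Z})$. -}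

module Defs where

open import Data.Nat as ℕ using (ℕ; _⊓_)
open import Data.Integer using (ℤ; +_; _+_; _-_; _*_; -_; _^_)
open import Data.Integer.Divisibility using (_∣_)
open import Data.List using (List; []; _∷_)
open import Data.Product using (Σ; ∃; _×_; _,_)
open import Relation.Nullary using (¬_)

-- Elements of ℤ/Nℤ are represented by integers; equality in ℤ/Nℤ
-- is congruence modulo N.
_≈[_]_ : ℤ → ℕ → ℤ → Set
a ≈[ N ] b = (+ N) ∣ (a - b)

IsUnit : ℕ → ℤ → Set
IsUnit N a = ∃ λ u → (u * a) ≈[ N ] (+ 1)

Triple : Set
Triple = ℤ × ℤ × ℤ

Primitive : ℕ → Triple → Set
Primitive N (X , Y , Z) =
  Σ ℤ λ u → Σ ℤ λ v → Σ ℤ λ w → (u * X + v * Y + w * Z) ≈[ N ] (+ 1)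

ProjEq : ℕ → Triple → Triple → Set
ProjEq N (X , Y , Z) (X' , Y' , Z') =
  Σ ℤ λ l → IsUnit N l × (X' ≈[ N ] (l * X)) × (Y' ≈[ N ] (l * Y)) × (Z' ≈[ N ] (l * Z))

OnCurve : ℕ → ℤ → ℤ → Triple → Set
OnCurve N A B P@(X , Y , Z) =
  Primitive N P × ((Y ^ 2 * Z) ≈[ N ] (X ^ 3 + A * X * Z ^ 2 + B * Z ^ 3))

AtInfinity : ℕ → ℤ → ℤ → Triple → Set
AtInfinity N A B P =
  OnCurve N A B P × ¬ (Σ ℤ λ X → Σ ℤ λ Y → ProjEq N P (X , Y , + 1))

-- polynomials in ℤ[x] as coefficient lists, constant term first
Poly : Set
Poly = List ℤ

eval : Poly → ℤ → ℤ
eval []       x = + 0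
eval (c ∷ cs) x = c + x * eval cs x

{-# OPTIONS --safe #-}

-- A point (X : Y : Z) at infinity has p ∣ Z, since otherwise Z is a unit and (X/Z : Y/Z : 1) represents it;
-- the curve equation then gives p ∣ X³, so p ∣ X, and primitivity makes Y a unit. Scaling by y = Y⁻¹ yields
-- the representative (x : 1 : ζ) with p ∣ x, p ∣ ζ and ζ ≡ φ x ζ, where φ x w = x³ + A x w² + B w³.
-- For p ∣ x the map φ x is a p-adic contraction, so ζ agrees modulo p^e with the e-th iterate of φ x
-- starting at 0. That iterate is a polynomial in x, and dropping its monomials of degree ≥ e does not
-- change its value modulo p^e. Consecutive iterates differ by multiples of p^(4n+3), so modulo p^10 the
-- iterate already equals the second one, x³ + A x⁷ + B x⁹.
module Submission where

open import Defs
open import Data.Nat using (ℕ; _≥_; _⊓_)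
open import Data.Nat.Primality using (Prime)
open import Data.Integer using (ℤ; +_; _+_; _-_; _*_; -_; _^_)
open import Data.Integer.Divisibility using (_∣_)
open import Data.List using (length)
open import Data.Product using (Σ; _×_; _,_)

open import Data.Nat as ℕ using (zero; suc; s≤s; z≤n)
import Data.Nat.Properties as ℕ
import Data.Nat.Divisibility as ℕ
open import Data.Nat.GeneralisedArithmetic using (fold)
open import Data.Nat.GCD using (module Bézout)
open import Data.Nat.Coprimality using (Coprime; coprime-Bézout)
open import Data.Nat.Primality using (prime⇒irreducible; euclidsLemma)
open import Data.Integer using (0ℤ; 1ℤ; ∣_∣)
open import Data.Integer.Properties
  using (*-zeroˡ; *-zeroʳ; *-identityʳ; +-identityˡ; +-identityʳ; *-assoc; *-comm;
         +-inverseʳ; neg-distribˡ-*; ^-identityʳ; ^-distribˡ-+-*; pos-+; pos-*; abs-*)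
open import Data.Integer.Divisibility.Signed
  using (divides; ∣ᵤ⇒∣; ∣⇒∣ᵤ; ∣-reflexive; ∣-trans; _∣?_; m∣∣m∣;
         ∣m∣n⇒∣m+n; ∣m⇒∣-m; ∣m∣n⇒∣m-n; ∣m⇒∣m*n; ∣n⇒∣m*n; *-monoʳ-∣; *-monoˡ-∣)
  renaming (_∣_ to _∣ˢ_)
open import Data.Integer.Tactic.RingSolver using (solve-∀)
open import Data.List using ([]; _∷_; map; take)
open import Data.List.Properties using (length-take)
open import Data.Product using (∃; proj₁; proj₂)
open import Data.Sum using (_⊎_; inj₁; inj₂; [_,_]′)
import Data.Sum as Sum
open import Data.Empty using (⊥-elim)
open import Function using (id)
open import Relation.Nullary using (¬_; yes; no)
open import Relation.Binary.PropositionalEquality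

infixl 6 _+ᴾ_
infixl 7 _*ᴾ_ _·ᴾ_

_+ᴾ_ : Poly → Poly → Poly
[]      +ᴾ g       = g
(c ∷ f) +ᴾ []      = c ∷ f
(c ∷ f) +ᴾ (d ∷ g) = c + d ∷ f +ᴾ g

_·ᴾ_ : ℤ → Poly → Poly
c ·ᴾ f = map (c *_) f

_*ᴾ_ : Poly → Poly → Poly
[]      *ᴾ g = []
(c ∷ f) *ᴾ g = c ·ᴾ g +ᴾ (0ℤ ∷ f *ᴾ g)

eval-+ᴾ : ∀ f g x → eval (f +ᴾ g) x ≡ eval f x + eval g x
eval-+ᴾ []      g       x = sym (+-identityˡ (eval g x))
eval-+ᴾ (c ∷ f) []      x = sym (+-identityʳ (eval (c ∷ f) x))
eval-+ᴾ (c ∷ f) (d ∷ g) x =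
  trans (cong (λ t → c + d + x * t) (eval-+ᴾ f g x)) (horner-+ c d x (eval f x) (eval g x))
  where
  horner-+ : ∀ c d x a b → c + d + x * (a + b) ≡ c + x * a + (d + x * b)
  horner-+ = solve-∀

eval-·ᴾ : ∀ c f x → eval (c ·ᴾ f) x ≡ c * eval f x
eval-·ᴾ c []      x = sym (*-zeroʳ c)
eval-·ᴾ c (d ∷ f) x =
  trans (cong (λ t → c * d + x * t) (eval-·ᴾ c f x)) (horner-· c d x (eval f x))
  where
  horner-· : ∀ c d x a → c * d + x * (c * a) ≡ c * (d + x * a)
  horner-· = solve-∀

eval-*ᴾ : ∀ f g x → eval (f *ᴾ g) x ≡ eval f x * eval g x
eval-*ᴾ []      g x = sym (*-zeroˡ (eval g x))
eval-*ᴾ (c ∷ f) g x = begin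
  eval (c ·ᴾ g +ᴾ (0ℤ ∷ f *ᴾ g)) x
    ≡⟨ eval-+ᴾ (c ·ᴾ g) (0ℤ ∷ f *ᴾ g) x ⟩
  eval (c ·ᴾ g) x + (0ℤ + x * eval (f *ᴾ g) x)
    ≡⟨ cong₂ (λ s t → s + (0ℤ + x * t)) (eval-·ᴾ c g x) (eval-*ᴾ f g x) ⟩
  c * eval g x + (0ℤ + x * (eval f x * eval g x))
    ≡⟨ horner-* c x (eval f x) (eval g x) ⟩
  (c + x * eval f x) * eval g x
    ∎
  where
  open ≡-Reasoning
  horner-* : ∀ c x a b → c * b + (0ℤ + x * (a * b)) ≡ (c + x * a) * b
  horner-* = solve-∀

*-pres-∣ : ∀ {a b c d} → a ∣ˢ b → c ∣ˢ d → a * c ∣ˢ b * d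
*-pres-∣ {b = b} {c = c} a∣b c∣d = ∣-trans (*-monoˡ-∣ c a∣b) (*-monoʳ-∣ b c∣d)

module PowerDivisibility (π : ℤ) where

  -- A record rather than π ^ n ∣ˢ a, so that n and a can be inferred from it.
  infix 4 π^_∣_
  record π^_∣_ (n : ℕ) (a : ℤ) : Set where
    constructor from-∣
    field to-∣ : π ^ n ∣ˢ a

  ∣-+ : ∀ {n a b} → π^ n ∣ a → π^ n ∣ b → π^ n ∣ a + b
  ∣-+ (from-∣ d) (from-∣ d′) = from-∣ (∣m∣n⇒∣m+n d d′)

  ∣-- : ∀ {n a b} → π^ n ∣ a → π^ n ∣ b → π^ n ∣ a - b
  ∣-- (from-∣ d) (from-∣ d′) = from-∣ (∣m∣n⇒∣m-n d d′)

  ∣-neg : ∀ {n a} → π^ n ∣ a → π^ n ∣ - a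
  ∣-neg (from-∣ d) = from-∣ (∣m⇒∣-m d)

  ∣-flip : ∀ {n} a b → π^ n ∣ a - b → π^ n ∣ b - a
  ∣-flip a b d = subst (π^ _ ∣_) (negate-diff a b) (∣-neg d)
    where
    negate-diff : ∀ a b → - (a - b) ≡ b - a
    negate-diff = solve-∀

  ∣-diff-trans : ∀ {n} a b c → π^ n ∣ a - b → π^ n ∣ b - c → π^ n ∣ a - c
  ∣-diff-trans a b c d d′ = subst (π^ _ ∣_) (sym (telescope a b c)) (∣-+ d d′)
    where
    telescope : ∀ a b c → a - c ≡ a - b + (b - c)
    telescope = solve-∀

  ∣-*ˡ : ∀ {n a} c → π^ n ∣ a → π^ n ∣ c * a
  ∣-*ˡ c (from-∣ d) = from-∣ (∣n⇒∣m*n c d)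

  ∣-*ʳ : ∀ {n a} c → π^ n ∣ a → π^ n ∣ a * c
  ∣-*ʳ c (from-∣ d) = from-∣ (∣m⇒∣m*n c d)

  ∣-0 : ∀ n → π^ n ∣ 0ℤ
  ∣-0 n = from-∣ (divides 0ℤ (sym (*-zeroˡ (π ^ n))))

  ∣-self-diff : ∀ n a → π^ n ∣ a - a
  ∣-self-diff n a = subst (π^ n ∣_) (sym (+-inverseʳ a)) (∣-0 n)

  ^0-∣ : ∀ a → π^ 0 ∣ a
  ^0-∣ a = from-∣ (divides a (sym (*-identityʳ a)))

  ∣-* : ∀ {m n a b} → π^ m ∣ a → π^ n ∣ b → π^ (m ℕ.+ n) ∣ a * b
  ∣-* {m} {n} (from-∣ d) (from-∣ d′) =
    from-∣ (subst (_∣ˢ _) (sym (^-distribˡ-+-* π m n)) (*-pres-∣ d d′))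

  ^-∣-^ : ∀ {m n} → m ℕ.≤ n → π ^ m ∣ˢ π ^ n
  ^-∣-^ {m} {n} m≤n = divides (π ^ (n ℕ.∸ m)) (begin
    π ^ n                  ≡⟨ cong (π ^_) (sym (ℕ.m+[n∸m]≡n m≤n)) ⟩
    π ^ (m ℕ.+ (n ℕ.∸ m))  ≡⟨ ^-distribˡ-+-* π m (n ℕ.∸ m) ⟩
    π ^ m * π ^ (n ℕ.∸ m)  ≡⟨ *-comm (π ^ m) _ ⟩
    π ^ (n ℕ.∸ m) * π ^ m  ∎)
    where open ≡-Reasoning

  ∣-weaken : ∀ {m n a} → m ℕ.≤ n → π^ n ∣ a → π^ m ∣ a
  ∣-weaken m≤n (from-∣ d) = from-∣ (∣-trans (^-∣-^ m≤n) d)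

  ∣⇒π^1∣ : ∀ {a} → π ∣ˢ a → π^ 1 ∣ a
  ∣⇒π^1∣ π∣a = from-∣ (∣-trans (∣-reflexive (^-identityʳ π)) π∣a)

  π^1∣⇒∣ : ∀ {a} → π^ 1 ∣ a → π ∣ˢ a
  π^1∣⇒∣ (from-∣ d) = ∣-trans (∣-reflexive (sym (^-identityʳ π))) d

  eval-take : ∀ {x} → π^ 1 ∣ x → ∀ n f → π^ n ∣ eval (take n f) x - eval f x
  eval-take π∣x zero    f       = ^0-∣ _
  eval-take π∣x (suc n) []      = ∣-0 _
  eval-take {x} π∣x (suc n) (c ∷ f) =
    subst (π^ _ ∣_) (sym (horner-- c x (eval (take n f) x) (eval f x))) (∣-* π∣x (eval-take π∣x n f))
    where
    horner-- : ∀ c x a b → c + x * a - (c + x * b) ≡ x * (a - b)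
    horner-- = solve-∀

  Invertible : ℕ → ℤ → Set
  Invertible n a = ∃ λ u → π^ n ∣ u * a - 1ℤ

  invertible-lift : ∀ {a} → Invertible 1 a → ∀ n → Invertible n a
  invertible-lift (u , _) zero    = u , ^0-∣ _
  invertible-lift {a} inv (suc n) = lift n
    where
    newton : ∀ v a → v * (1ℤ - (v * a - 1ℤ)) * a - 1ℤ ≡ - ((v * a - 1ℤ) * (v * a - 1ℤ))
    newton = solve-∀
    lift : ∀ n → Invertible (suc n) a
    lift zero    = inv
    lift (suc n) with lift n
    ... | v , d = v * (1ℤ - (v * a - 1ℤ)) ,
      subst (π^ _ ∣_) (sym (newton v a)) (∣-neg (∣-weaken (s≤s (ℕ.m≤n+m (suc n) n)) (∣-* d d)))

-- (x : 1 : w) lies on E_{A,B} exactly when w = φ A B x w.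
φ : ℤ → ℤ → ℤ → ℤ → ℤ
φ A B x w = x * x * x + A * x * (w * w) + B * (w * w * w)

approx : ℤ → ℤ → ℤ → ℕ → ℤ
approx A B x n = fold 0ℤ (φ A B x) n

slope : ℤ → ℤ → ℤ → ℤ → ℤ → ℤ
slope A B x a b = A * x * (a + b) + B * (a * a + a * b + b * b)

-- The ring solver neither unfolds φ nor accepts Data.Integer's _^_, so both are written out in its goals.
φ-difference : ∀ A B x a b → φ A B x a - φ A B x b ≡ slope A B x a b * (a - b)
φ-difference = expanded
  where
  expanded : ∀ A B x a b → x * x * x + A * x * (a * a) + B * (a * a * a) - (x * x * x + A * x * (b * b) + B * (b * b * b))
                         ≡ (A * x * (a + b) + B * (a * a + a * b + b * b)) * (a - b)
  expanded = solve-∀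

approx-2 : ∀ A B x → approx A B x 2 ≡ x ^ 3 + A * x ^ 7 + B * x ^ 9
approx-2 A B x = trans (cong (φ A B x) (φ-at-0 A B x)) (expand A B x)
  where
  φ-at-0 : ∀ A B x → x * x * x + A * x * (0ℤ * 0ℤ) + B * (0ℤ * 0ℤ * 0ℤ) ≡ x * x * x
  φ-at-0 = solve-∀
  expand : ∀ A B x → x * x * x + A * x * ((x * x * x) * (x * x * x)) + B * ((x * x * x) * (x * x * x) * (x * x * x))
                   ≡ x * (x * (x * 1ℤ))
                     + A * (x * (x * (x * (x * (x * (x * (x * 1ℤ)))))))
                     + B * (x * (x * (x * (x * (x * (x * (x * (x * (x * 1ℤ)))))))))
  expand = solve-∀

x³ᴾ : Poly
x³ᴾ = 0ℤ ∷ 0ℤ ∷ 0ℤ ∷ 1ℤ ∷ []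

φᴾ : ℤ → ℤ → Poly → Poly
φᴾ A B g = x³ᴾ +ᴾ (0ℤ ∷ A ·ᴾ (g *ᴾ g)) +ᴾ B ·ᴾ (g *ᴾ g *ᴾ g)

eval-φᴾ : ∀ A B g x → eval (φᴾ A B g) x ≡ φ A B x (eval g x)
eval-φᴾ A B g x = begin
  eval (φᴾ A B g) x
    ≡⟨ eval-+ᴾ (x³ᴾ +ᴾ (0ℤ ∷ A ·ᴾ (g *ᴾ g))) (B ·ᴾ (g *ᴾ g *ᴾ g)) x ⟩
  eval (x³ᴾ +ᴾ (0ℤ ∷ A ·ᴾ (g *ᴾ g))) x + eval (B ·ᴾ (g *ᴾ g *ᴾ g)) x
    ≡⟨ cong₂ _+_ (eval-+ᴾ x³ᴾ (0ℤ ∷ A ·ᴾ (g *ᴾ g)) x) (eval-·ᴾ B (g *ᴾ g *ᴾ g) x) ⟩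
  eval x³ᴾ x + (0ℤ + x * eval (A ·ᴾ (g *ᴾ g)) x) + B * eval (g *ᴾ g *ᴾ g) x
    ≡⟨ cong₂ (λ s t → eval x³ᴾ x + (0ℤ + x * s) + B * t)
             (trans (eval-·ᴾ A (g *ᴾ g) x) (cong (A *_) square))
             (trans (eval-*ᴾ (g *ᴾ g) g x) (cong (_* w) square)) ⟩
  eval x³ᴾ x + (0ℤ + x * (A * (w * w))) + B * (w * w * w)
    ≡⟨ collect A B x w ⟩
  φ A B x w ∎
  where
  open ≡-Reasoning
  w : ℤ
  w = eval g x
  square : eval (g *ᴾ g) x ≡ w * w
  square = eval-*ᴾ g g x
  collect : ∀ A B x w → 0ℤ + x * (0ℤ + x * (0ℤ + x * (1ℤ + x * 0ℤ))) + (0ℤ + x * (A * (w * w))) + B * (w * w * w)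
                      ≡ x * x * x + A * x * (w * w) + B * (w * w * w)
  collect = solve-∀

approxᴾ : ℤ → ℤ → ℕ → Poly
approxᴾ A B n = fold [] (φᴾ A B) n

eval-approxᴾ : ∀ A B n x → eval (approxᴾ A B n) x ≡ approx A B x n
eval-approxᴾ A B zero    x = refl
eval-approxᴾ A B (suc n) x = trans (eval-φᴾ A B (approxᴾ A B n) x) (cong (φ A B x) (eval-approxᴾ A B n x))

module Approximation (π A B : ℤ) {x : ℤ} where
  open PowerDivisibility π

  module _ (π∣x : π^ 1 ∣ x) where

    φ-divisible : ∀ {w} → π^ 1 ∣ w → π^ 3 ∣ φ A B x w
    φ-divisible π∣w = ∣-+ (∣-+ (∣-* (∣-* π∣x π∣x) π∣x) (∣-* (∣-*ˡ A π∣x) (∣-* π∣w π∣w)))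
                          (∣-*ˡ B (∣-* (∣-* π∣w π∣w) π∣w))

    approx-divisible : ∀ n → π^ 3 ∣ approx A B x n
    approx-divisible zero    = ∣-0 3
    approx-divisible (suc n) = φ-divisible (∣-weaken (s≤s z≤n) (approx-divisible n))

    slope-divisible : ∀ {k a b} → π^ suc k ∣ a → π^ suc k ∣ b → π^ (2 ℕ.+ k) ∣ slope A B x a b
    slope-divisible {k} π∣a π∣b =
      ∣-+ (∣-* (∣-*ˡ A π∣x) (∣-+ π∣a π∣b))
          (∣-*ˡ B (∣-+ (∣-+ (product π∣a π∣a) (product π∣a π∣b)) (product π∣b π∣b)))
      where
      product : ∀ {a b} → π^ suc k ∣ a → π^ suc k ∣ b → π^ (2 ℕ.+ k) ∣ a * b
      product π∣a π∣b = ∣-weaken (s≤s (ℕ.m≤n+m (suc k) k)) (∣-* π∣a π∣b)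

    -- The exponent n * 4 + 3 makes the case suc n reduce to 4 + (n * 4 + 3).
    approx-step : ∀ n → π^ (n ℕ.* 4 ℕ.+ 3) ∣ approx A B x (suc n) - approx A B x n
    approx-step zero    = subst (π^ 3 ∣_) (sym (+-identityʳ _)) (φ-divisible (∣-0 1))
    approx-step (suc n) =
      subst (π^ _ ∣_) (sym (φ-difference A B x (approx A B x (suc n)) (approx A B x n)))
            (∣-* (slope-divisible (approx-divisible (suc n)) (approx-divisible n)) (approx-step n))

    approx-unique : ∀ {y e} → π^ 1 ∣ y → π^ e ∣ φ A B x y - y → ∀ n → n ℕ.≤ e → π^ n ∣ y - approx A B x n
    approx-unique π∣y fixed zero    _   = ^0-∣ _
    approx-unique {y} π∣y fixed (suc n) n<e =
      ∣-diff-trans y (φ A B x y) (φ A B x (approx A B x n))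
        (∣-flip (φ A B x y) y (∣-weaken n<e fixed))
        (subst (π^ _ ∣_) (sym (φ-difference A B x y (approx A B x n))) (∣-* contraction previous))
      where
      contraction : π^ 1 ∣ slope A B x y (approx A B x n)
      contraction = ∣-weaken (s≤s z≤n) (slope-divisible π∣y (∣-weaken (s≤s z≤n) (approx-divisible n)))
      previous : π^ n ∣ y - approx A B x n
      previous = approx-unique π∣y fixed n (ℕ.<⇒≤ n<e)

    approx-stable : ∀ {m n} → n ℕ.≤ m ℕ.* 4 ℕ.+ 3 → π^ n ∣ approx A B x m - approx A B x n
    approx-stable {m} {n} = approx-unique (∣-weaken (s≤s z≤n) (approx-divisible m)) (approx-step m) n

    truncated-approxᴾ : ∀ n → π^ n ∣ eval (take n (approxᴾ A B n)) x - approx A B x n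
    truncated-approxᴾ n = subst (λ t → π^ n ∣ eval (take n (approxᴾ A B n)) x - t) (eval-approxᴾ A B n x)
                                (eval-take π∣x n (approxᴾ A B n))

    truncated-approxᴾ-leading : ∀ e →
      π^ (10 ⊓ e) ∣ eval (take e (approxᴾ A B e)) x - (x ^ 3 + A * x ^ 7 + B * x ^ 9)
    truncated-approxᴾ-leading e =
      subst (λ t → π^ n ∣ eval f x - t) (approx-2 A B x)
        (∣-diff-trans (eval f x) (approx A B x e) (approx A B x 2)
          (∣-weaken (ℕ.m⊓n≤n 10 e) (truncated-approxᴾ e))
          (∣-diff-trans (approx A B x e) (approx A B x n) (approx A B x 2)
            (approx-stable {e} n≤e*4+3)
            (∣-flip (approx A B x 2) (approx A B x n) (approx-stable {2} n≤2*4+3))))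
      where
      n : ℕ
      n = 10 ⊓ e
      n≤e*4+3 : n ℕ.≤ e ℕ.* 4 ℕ.+ 3
      n≤e*4+3 = ℕ.≤-trans (ℕ.m⊓n≤n 10 e) (ℕ.≤-trans (ℕ.m≤m*n e 4) (ℕ.m≤m+n (e ℕ.* 4) 3))
      n≤2*4+3 : n ℕ.≤ 2 ℕ.* 4 ℕ.+ 3
      n≤2*4+3 = ℕ.≤-trans (ℕ.m⊓n≤m 10 e) (ℕ.n≤1+n 10)
      f : Poly
      f = take e (approxᴾ A B e)

pos-^ : ∀ m n → + (m ℕ.^ n) ≡ (+ m) ^ n
pos-^ m zero    = refl
pos-^ m (suc n) = trans (pos-* m (m ℕ.^ n)) (cong (_*_ (+ m)) (pos-^ m n))

module _ (m : ℕ) where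
  open PowerDivisibility (+ m)

  π^∣⇒≈ : ∀ {n} a b → π^ n ∣ a - b → a ≈[ m ℕ.^ n ] b
  π^∣⇒≈ {n} _ _ (from-∣ d) = ∣⇒∣ᵤ (subst (_∣ˢ _) (sym (pos-^ m n)) d)

  ≈⇒π^∣ : ∀ {n} a b → a ≈[ m ℕ.^ n ] b → π^ n ∣ a - b
  ≈⇒π^∣ {n} _ _ d = from-∣ (subst (_∣ˢ _) (pos-^ m n) (∣ᵤ⇒∣ d))

  projEq : ∀ {n} X Y Z X′ Y′ Z′ l → Invertible n l →
           π^ n ∣ X′ - l * X → π^ n ∣ Y′ - l * Y → π^ n ∣ Z′ - l * Z →
           ProjEq (m ℕ.^ n) (X , Y , Z) (X′ , Y′ , Z′)
  projEq X Y Z X′ Y′ Z′ l (l⁻¹ , inv) dX dY dZ =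
    l , (l⁻¹ , π^∣⇒≈ (l⁻¹ * l) 1ℤ inv) , π^∣⇒≈ X′ (l * X) dX , π^∣⇒≈ Y′ (l * Y) dY , π^∣⇒≈ Z′ (l * Z) dZ

bezout-ℤ : ∀ {d m n} → Bézout.Identity d m n → ∃ λ u → + m ∣ˢ u * + n - + d
bezout-ℤ {d} {m} {n} (Bézout.+- x y eq) = - + y , divides (- + x) (begin
  - + y * + n - + d    ≡⟨ negate-sum (+ d) (+ y) (+ n) ⟩
  - (+ d + + y * + n)  ≡⟨ cong -_ (pos-identity eq) ⟩
  - (+ x * + m)        ≡⟨ neg-distribˡ-* (+ x) (+ m) ⟩
  - + x * + m          ∎)
  where
  open ≡-Reasoning
  negate-sum : ∀ d y n → - y * n - d ≡ - (d + y * n)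
  negate-sum = solve-∀
  pos-identity : d ℕ.+ y ℕ.* n ≡ x ℕ.* m → + d + + y * + n ≡ + x * + m
  pos-identity eq = trans (sym (trans (pos-+ d (y ℕ.* n)) (cong (_+_ (+ d)) (pos-* y n)))) (trans (cong +_ eq) (pos-* x m))
bezout-ℤ {d} {m} {n} (Bézout.-+ x y eq) = + y , divides (+ x) (begin
  + y * + n - + d              ≡⟨ cong (_- + d) (sym (pos-identity eq)) ⟩
  + d + + x * + m - + d        ≡⟨ cancel (+ d) (+ x * + m) ⟩
  + x * + m                    ∎)
  where
  open ≡-Reasoning
  cancel : ∀ d a → d + a - d ≡ a
  cancel = solve-∀
  pos-identity : d ℕ.+ x ℕ.* m ≡ y ℕ.* n → + d + + x * + m ≡ + y * + n
  pos-identity eq = trans (sym (trans (pos-+ d (x ℕ.* m)) (cong (_+_ (+ d)) (pos-* x m)))) (trans (cong +_ eq) (pos-* y n))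

module _ {p : ℕ} (isPrime : Prime p) where
  open PowerDivisibility (+ p)

  prime-∣-* : ∀ {a b} → + p ∣ˢ a * b → + p ∣ˢ a ⊎ + p ∣ˢ b
  prime-∣-* {a} {b} p∣ab =
    Sum.map ∣ᵤ⇒∣ ∣ᵤ⇒∣ (euclidsLemma ∣ a ∣ ∣ b ∣ isPrime (subst (p ℕ.∣_) (abs-* a b) (∣⇒∣ᵤ p∣ab)))

  prime-∣-^ : ∀ {a} n → + p ∣ˢ a ^ suc n → + p ∣ˢ a
  prime-∣-^ zero    p∣a = ∣-trans p∣a (∣-reflexive (^-identityʳ _))
  prime-∣-^ (suc n) p∣a = [ id , prime-∣-^ n ]′ (prime-∣-* p∣a)

  prime∤⇒coprime : ∀ {a} → ¬ (+ p ∣ˢ a) → Coprime p ∣ a ∣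
  prime∤⇒coprime p∤a (d∣p , d∣a) with prime⇒irreducible isPrime d∣p
  ... | inj₁ d≡1  = d≡1
  ... | inj₂ refl = ⊥-elim (p∤a (∣ᵤ⇒∣ d∣a))

  prime∤⇒invertible : ∀ {a} → ¬ (+ p ∣ˢ a) → Invertible 1 a
  prime∤⇒invertible {a} p∤a with bezout-ℤ (coprime-Bézout (prime∤⇒coprime p∤a)) | m∣∣m∣ {a}
  ... | u , p∣u∣a∣-1 | divides s ∣a∣≡sa =
    u * s , ∣⇒π^1∣ (subst (λ t → + p ∣ˢ t - 1ℤ) (trans (cong (u *_) ∣a∣≡sa) (sym (*-assoc u s a))) p∣u∣a∣-1)

module PointsAtInfinity {p : ℕ} (isPrime : Prime p) (A B : ℤ) {e : ℕ} (1≤e : 1 ℕ.≤ e) where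
  open PowerDivisibility (+ p)
  open Approximation (+ p) A B

  Z-divisible : ∀ {X Y Z} → AtInfinity (p ℕ.^ e) A B (X , Y , Z) → π^ 1 ∣ Z
  Z-divisible {X} {Y} {Z} (_ , noAffine) with + p ∣? Z
  ... | yes p∣Z = ∣⇒π^1∣ p∣Z
  ... | no  p∤Z with invertible-lift (prime∤⇒invertible isPrime p∤Z) e
  ...   | v , π^e∣vZ-1 = ⊥-elim (noAffine (v * X , v * Y , affine))
    where
    affine : ProjEq (p ℕ.^ e) (X , Y , Z) (v * X , v * Y , 1ℤ)
    affine = projEq p X Y Z (v * X) (v * Y) 1ℤ v (Z , subst (π^ e ∣_) (cong (_- 1ℤ) (*-comm v Z)) π^e∣vZ-1)
                    (∣-self-diff e (v * X)) (∣-self-diff e (v * Y))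
                    (∣-flip (v * Z) 1ℤ π^e∣vZ-1)

  X-divisible : ∀ {X Y Z} → OnCurve (p ℕ.^ e) A B (X , Y , Z) → π^ 1 ∣ Z → π^ 1 ∣ X
  X-divisible {X} {Y} {Z} (_ , curve) π∣Z = ∣⇒π^1∣ (prime-∣-^ isPrime 2 (π^1∣⇒∣ π∣X³))
    where
    isolate : ∀ a b c d → a ≡ b - c - d - (b - (a + c + d))
    isolate = solve-∀
    π∣X³ : π^ 1 ∣ X ^ 3
    π∣X³ = subst (π^ 1 ∣_) (sym (isolate (X ^ 3) (Y ^ 2 * Z) (A * X * Z ^ 2) (B * Z ^ 3)))
             (∣-- (∣-- (∣-- (∣-*ˡ (Y ^ 2) π∣Z) (∣-*ˡ (A * X) (∣-*ʳ (Z ^ 1) π∣Z))) (∣-*ˡ B (∣-*ʳ (Z ^ 2) π∣Z)))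
                  (∣-weaken 1≤e (≈⇒π^∣ p (Y ^ 2 * Z) (X ^ 3 + A * X * Z ^ 2 + B * Z ^ 3) curve)))

  Y-invertible : ∀ {X Y Z} → OnCurve (p ℕ.^ e) A B (X , Y , Z) → π^ 1 ∣ X → π^ 1 ∣ Z → Invertible e Y
  Y-invertible {X} {Y} {Z} ((u , v , w , generates) , _) π∣X π∣Z =
    invertible-lift (v , subst (π^ 1 ∣_) (sym (isolate u v w X Y Z))
      (∣-- (∣-- (∣-weaken 1≤e (≈⇒π^∣ p (u * X + v * Y + w * Z) 1ℤ generates)) (∣-*ˡ u π∣X)) (∣-*ˡ w π∣Z))) e
    where
    isolate : ∀ u v w X Y Z → v * Y - 1ℤ ≡ u * X + v * Y + w * Z - 1ℤ - u * X - w * Z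
    isolate = solve-∀

  dehomogenise : ∀ {X Y Z} → OnCurve (p ℕ.^ e) A B (X , Y , Z) →
                 ∀ y → π^ e ∣ y * Y - 1ℤ → π^ e ∣ φ A B (y * X) (y * Z) - y * Z
  dehomogenise {X} {Y} {Z} (_ , curve) y π^e∣yY-1 =
    subst (π^ e ∣_) (sym (scale A B X Y Z y))
      (∣-+ (∣-*ˡ (- (y * y * y)) (≈⇒π^∣ p (Y ^ 2 * Z) (X ^ 3 + A * X * Z ^ 2 + B * Z ^ 3) curve))
           (∣-*ˡ (y * Z * (y * Y + 1ℤ)) π^e∣yY-1))
    where
    scale : ∀ A B X Y Z y →
      y * X * (y * X) * (y * X) + A * (y * X) * (y * Z * (y * Z)) + B * (y * Z * (y * Z) * (y * Z)) - y * Z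
      ≡ - (y * y * y) * (Y * (Y * 1ℤ) * Z - (X * (X * (X * 1ℤ)) + A * X * (Z * (Z * 1ℤ)) + B * (Z * (Z * (Z * 1ℤ)))))
        + y * Z * (y * Y + 1ℤ) * (y * Y - 1ℤ)
    scale = solve-∀

  normal-form : (P : Triple) → AtInfinity (p ℕ.^ e) A B P →
                Σ ℤ λ x → (+ p ∣ x) × ProjEq (p ℕ.^ e) P (x , 1ℤ , eval (take e (approxᴾ A B e)) x)
  normal-form (X , Y , Z) atInfinity =
    y * X , ∣⇒∣ᵤ (π^1∣⇒∣ π∣x) ,
    projEq p X Y Z (y * X) 1ℤ (eval f (y * X)) y (Y , subst (π^ e ∣_) (cong (_- 1ℤ) (*-comm y Y)) π^e∣yY-1)
           (∣-self-diff e (y * X)) (∣-flip (y * Y) 1ℤ π^e∣yY-1) on-f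
    where
    onCurve : OnCurve (p ℕ.^ e) A B (X , Y , Z)
    onCurve = proj₁ atInfinity
    π∣Z : π^ 1 ∣ Z
    π∣Z = Z-divisible atInfinity
    π∣X : π^ 1 ∣ X
    π∣X = X-divisible onCurve π∣Z
    Y⁻¹ : Invertible e Y
    Y⁻¹ = Y-invertible onCurve π∣X π∣Z
    y : ℤ
    y = proj₁ Y⁻¹
    π^e∣yY-1 : π^ e ∣ y * Y - 1ℤ
    π^e∣yY-1 = proj₂ Y⁻¹
    f : Poly
    f = take e (approxᴾ A B e)
    π∣x : π^ 1 ∣ y * X
    π∣x = ∣-*ˡ y π∣X
    ζ-approx : π^ e ∣ y * Z - approx A B (y * X) e
    ζ-approx = approx-unique π∣x (∣-*ˡ y π∣Z) (dehomogenise onCurve y π^e∣yY-1) e ℕ.≤-refl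
    on-f : π^ e ∣ eval f (y * X) - y * Z
    on-f = ∣-diff-trans (eval f (y * X)) (approx A B (y * X) e) (y * Z) (truncated-approxᴾ π∣x e)
                        (∣-flip (y * Z) (approx A B (y * X) e) ζ-approx)

proposition3p4 : (p e : ℕ) → Prime p → e ≥ 1 → (A B : ℤ) →
    IsUnit (p Data.Nat.^ e) (- (+ 4 * A ^ 3 + + 27 * B ^ 2)) →
    Σ Poly λ f →
      (length f Data.Nat.≤ e)
      × ((P : Triple) → AtInfinity (p Data.Nat.^ e) A B P →
          Σ ℤ λ X → ((+ p) ∣ X) × ProjEq (p Data.Nat.^ e) P (X , + 1 , eval f X))
      × ((X : ℤ) → (+ p) ∣ X →
          (+ (p Data.Nat.^ (10 ⊓ e))) ∣ (eval f X - (X ^ 3 + A * X ^ 7 + B * X ^ 9)))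
proposition3p4 p e isPrime 1≤e A B _ = f , length-bound , normal-form , leading-terms
  where
  open PowerDivisibility (+ p)
  open Approximation (+ p) A B
  open PointsAtInfinity isPrime A B 1≤e
  f : Poly
  f = take e (approxᴾ A B e)
  length-bound : length f ℕ.≤ e
  length-bound = subst (ℕ._≤ e) (sym (length-take e (approxᴾ A B e))) (ℕ.m⊓n≤m e _)
  leading-terms : (X : ℤ) → + p ∣ X → + (p ℕ.^ (10 ⊓ e)) ∣ eval f X - (X ^ 3 + A * X ^ 7 + B * X ^ 9)
  leading-terms X p∣X =
    π^∣⇒≈ p (eval f X) (X ^ 3 + A * X ^ 7 + B * X ^ 9) (truncated-approxᴾ-leading {X} (∣⇒π^1∣ (∣ᵤ⇒∣ p∣X)) e)
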